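{- Let $\mathcal{H}$ be a home-base hypergraph with vertex classes $V_1,V_2,V_3$ and a home-base partition $(\mathcal{F},\mathcal{R},W)$. Then for every pair $i,j\in\{1,2,3\}$ with $i\neq j$, the $i$-heavy $(i,j)$-cover of $\mathcal{H}$ is a minimal vertex cover of $\mathcal{H}$.
   Context: A $3$-partite $3$-graph has vertex classes $V_1,V_2,V_3$ with each edge (edges form a multiset) containing one vertex from each class; $\nu$ is the matching number; $\mathcal{H}|_U$ is the hypergraph of edges contained in $U$. Truncated Fano plane: the $3$-graph on $\{a,b,c,x,y,z\}$ with edges $abc,ayz,xbz,xyc$; truncated multi-Fano plane: obtained by adding parallel copies of edges. An FR-partition is a triple $(\mathcal{F},\mathcal{R},W)$ with (1) $\mathcal{F}\cup\mathcal{R}\cup\{W\}$ a partition of $V(\mathcal{H})$; (2) each $\mathcal{H}|_F$, $F\in\mathcal{F}$, isomorphic to a truncated multi-Fano plane; (3) each $R\in\mathcal{R}$ a $3$-set with one vertex per class; (4) $|\mathcal{F}\cup\mathcal{R}|=\nu(\mathcal{H})$. $B_i$ denotes the bipartite graph with classes $\mathcal{R}$ and $W\cap V_i$, $R\sim w$ iff some edge contains $w$ and two vertices of $R$. A home-base partition is an FR-partition such that every $B_i$ has a matching saturating $\mathcal{R}$ and every edge lies in some $\mathcal{H}|_F$ ($F\in\mathcal{F}$) or contains two vertices of some $R\in\mathcal{R}$; a home-base hypergraph is one having a home-base partition. A subset $C\subseteq W\cap V_i$ is essential in $B_i$ if $C=N_{B_i}(U)$ for some $U\subseteq\mathcal{R}$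 with $|U|=|C|$; $W\cap V_i$ has a unique maximal essential subset $C_i$. Let $\mathcal{U}_i\subseteq\mathcal{R}$ be a set with $|\mathcal{U}_i|=|C_i|$ and $N_{B_i}(\mathcal{U}_i)=C_i$. The $i$-heavy $(i,j)$-cover of $\mathcal{H}$ is the union of $C_i\cup\big((V(\mathcal{F})\cup V(\mathcal{R}))\cap V_i\big)$ and $\big(\bigcup_{R\in\mathcal{R}\setminus\mathcal{U}_i}R\big)\cap V_j$, where $V(\mathcal{F})=\bigcup\mathcal{F}$ and $V(\mathcal{R})=\bigcup\mathcal{R}$. -}

module Defs where

open import Data.Nat using (ℕ; _+_; _≤_)
open import Data.Fin using (Fin; zero; suc)
open import Data.Fin.Subset using (Subset; _∈_; _∉_; ∣_∣)
open import Data.Product using (Σ; ∃; ∃-syntax; _×_; _,_)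
open import Data.Sum using (_⊎_)
import Data.Sum
import Data.Product
open import Relation.Binary.PropositionalEquality using (_≡_; _≢_)
open import Relation.Nullary using (¬_)
open import Function.Bundles using (_⇔_)
open import Function.Definitions using (Injective)

-- 3-partite 3-graphs (edges form a multiset: edges are indexed by Fin m,
-- so parallel edges are allowed).  Vertex classes V₁,V₂,V₃ are the
-- fibres of cls over 0,1,2.  An edge is a map Fin 3 → vertices whose
-- k-th vertex lies in class k.

record Hyp : Set where
  field
    n        : ℕ
    m        : ℕ
    cls      : Fin n → Fin 3
    edge     : Fin m → Fin 3 → Fin n
    edge-cls : ∀ e k → cls (edge e k) ≡ k

open Hyp public

module _ (H : Hyp) where

  _∈E_ : Fin (n H) → Fin (m H) → Set
  v ∈E e = ∃[ k ] edge H e k ≡ v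

  HasMatching : ℕ → Set
  HasMatching k = Σ (Fin k → Fin (m H)) λ M →
    ∀ p q → p ≢ q → ∀ a b → edge H (M p) a ≢ edge H (M q) b

  IsMatchingNumber : ℕ → Set
  IsMatchingNumber k = HasMatching k × (∀ l → HasMatching l → l ≤ k)

  IsCover : (Fin (n H) → Set) → Set
  IsCover S = ∀ e → ∃[ k ] S (edge H e k)

  IsMinimalCover : (Fin (n H) → Set) → Set₁
  IsMinimalCover S = IsCover S ×
    (∀ (S' : Fin (n H) → Set) → (∀ v → S' v → S v) → IsCover S' →
       ∀ v → S v → S' v)

  -- Truncated multi-Fano planes.
  -- A labelling φ : Fin 6 → V with φ 0..5 = a,b,c,x,y,z.  The four
  -- triples abc, ayz, xbz, xyc:

  fanoTriple : Fin 4 → Fin 3 → Fin 6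
  fanoTriple zero                   zero             = zero
  fanoTriple zero                   (suc zero)       = suc zero
  fanoTriple zero                   (suc (suc zero)) = suc (suc zero)
  fanoTriple (suc zero)             zero             = zero
  fanoTriple (suc zero)             (suc zero)       = suc (suc (suc (suc zero)))
  fanoTriple (suc zero)             (suc (suc zero)) = suc (suc (suc (suc (suc zero))))
  fanoTriple (suc (suc zero))       zero             = suc (suc (suc zero))
  fanoTriple (suc (suc zero))       (suc zero)       = suc zero
  fanoTriple (suc (suc zero))       (suc (suc zero)) = suc (suc (suc (suc (suc zero))))
  fanoTriple (suc (suc (suc zero))) zero             = suc (suc (suc zero))
  fanoTriple (suc (suc (suc zero))) (suc zero)       = suc (suc (suc (suc zero)))
  fanoTriple (suc (suc (suc zero))) (suc (suc zero)) = suc (suc zero)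

  EdgeIs : Fin (m H) → (Fin 3 → Fin (n H)) → Set
  EdgeIs e t = ∀ v → (v ∈E e) ⇔ (∃[ k ] t k ≡ v)

  -- H|_{φ[Fin 6]} is isomorphic to a truncated multi-Fano plane via the
  -- labelling φ: every edge of H contained in φ[Fin 6] is (as a vertex
  -- set) one of abc, ayz, xbz, xyc, and each of these four occurs as an
  -- edge (with multiplicity ≥ 1).
  IsTruncMultiFano : (Fin 6 → Fin (n H)) → Set
  IsTruncMultiFano φ =
    Injective _≡_ _≡_ φ ×
    (∀ e → (∀ k → ∃[ s ] φ s ≡ edge H e k) →
       ∃[ t ] EdgeIs e (λ k → φ (fanoTriple t k))) ×
    (∀ t → ∃[ e ] EdgeIs e (λ k → φ (fanoTriple t k)))

  -- FR-partitions.  𝓕 is indexed by Fin f (each F ∈ 𝓕 given with a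
  -- labelling a,b,c,x,y,z), 𝓡 by Fin r (each R given as the map k ↦ its
  -- vertex in class k), and W is the set of remaining vertices.

  Slot : ℕ → ℕ → Set
  Slot f r = (Fin f × Fin 6) ⊎ (Fin r × Fin 3)

  record FRPartition : Set where
    field
      f   : ℕ
      r   : ℕ
      fv  : Fin f → Fin 6 → Fin (n H)
      rv  : Fin r → Fin 3 → Fin (n H)
      -- (1) the F's and R's are pairwise disjoint sets of the stated sizes
      --     (W is the complement, defined below)
      disjoint : Injective _≡_ _≡_
                   (Data.Sum.[ (λ p → fv (Data.Product.proj₁ p) (Data.Product.proj₂ p))
                             , (λ p → rv (Data.Product.proj₁ p) (Data.Product.proj₂ p)) ])
      fano : ∀ F → IsTruncMultiFano (fv F)
      rcls : ∀ R k → H .cls (rv R k) ≡ k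
      size : IsMatchingNumber (f + r)

    InW : Fin (n H) → Set
    InW v = (∀ F s → fv F s ≢ v) × (∀ R k → rv R k ≢ v)

    InFR : Fin (n H) → Set
    InFR v = (∃[ F ] ∃[ s ] fv F s ≡ v) ⊎ (∃[ R ] ∃[ k ] rv R k ≡ v)

    ContainsTwo : Fin (m H) → Fin r → Set
    ContainsTwo e R = ∃[ p ] ∃[ q ] p ≢ q × (rv R p ∈E e) × (rv R q ∈E e)

    -- the bipartite graph B_i between 𝓡 and W ∩ V_i
    Adj : Fin 3 → Fin r → Fin (n H) → Set
    Adj i R w = H .cls w ≡ i × InW w × ∃[ e ] (w ∈E e) × ContainsTwo e R

    Saturating : Fin 3 → Set
    Saturating i = Σ (Fin r → Fin (n H)) λ σ →
      Injective _≡_ _≡_ σ × (∀ R → Adj i R (σ R))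

    NbhdIs : Fin 3 → Subset r → Subset (n H) → Set
    NbhdIs i U C = ∀ w → (w ∈ C) ⇔ (∃[ R ] R ∈ U × Adj i R w)

    Essential : Fin 3 → Subset (n H) → Set
    Essential i C = (∀ w → w ∈ C → H .cls w ≡ i × InW w) ×
      (∃[ U ] ∣ U ∣ ≡ ∣ C ∣ × NbhdIs i U C)

    IsMaxEssential : Fin 3 → Subset (n H) → Set
    IsMaxEssential i C = Essential i C ×
      (∀ C' → Essential i C' → (∀ w → w ∈ C → w ∈ C') → ∀ w → w ∈ C' → w ∈ C)

    -- the i-heavy (i,j)-cover, given C = C_i and U = 𝓤_i
    HeavyCover : Fin 3 → Fin 3 → Subset (n H) → Subset r → Fin (n H) → Set
    HeavyCover i j C U v =
      (v ∈ C) ⊎ (H .cls v ≡ i × InFR v) ⊎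
      (H .cls v ≡ j × ∃[ R ] R ∉ U × ∃[ k ] rv R k ≡ v)

  IsHomeBase : FRPartition → Set
  IsHomeBase P = (∀ i → Saturating i) ×
    (∀ e → (∃[ F ] ∀ k → ∃[ s ] fv F s ≡ edge H e k) ⊎ (∃[ R ] ContainsTwo e R))
    where open FRPartition P

-- Every vertex v of the i-heavy (i,j)-cover T has a private edge, one meeting T only in v, so no
-- proper subset of T is a cover.  For v ∈ Cᵢ the edge joins v to its neighbour R ∈ 𝓤ᵢ in Bᵢ; for
-- v ∈ F ∈ 𝓕 it is a Fano line through v, whose cover vertices all lie in Vᵢ; for v ∈ R it is R with
-- its vertex in the other class of {i, j} replaced by the partner of R in a saturating matching of
-- Bⱼ resp. Bᵢ.  When R ∉ 𝓤ᵢ that partner avoids Cᵢ: the matching maps 𝓤ᵢ injectively into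
-- N(𝓤ᵢ) = Cᵢ, and one more vertex of Cᵢ would give |Cᵢ| > |𝓤ᵢ|.
-- T is a cover because an edge not inside some F contains two vertices of some R: either its
-- class-i vertex is R's, or its class-j vertex is R's and lies in T unless R ∈ 𝓤ᵢ, in which case
-- its class-i vertex is in V(𝓕) ∪ V(𝓡) or is a W-neighbour of R in Bᵢ, hence in Cᵢ.
module Submission where

open import Defs
open import Data.Fin using (Fin; zero; suc; _≟_; punchOut)
open import Data.Fin.Properties using (any?; punchOut-injective; suc-injective; 0≢1+n)
open import Data.Fin.Subset using (Subset; ∣_∣; _∈_; _∉_; inside; outside)
open import Data.Fin.Subset.Properties using (x∈p∧x≢y⇒x∈p-y; x∈p⇒∣p-x∣<∣p∣; _∈?_)
open import Data.Vec.Base using ([]; _∷_; here; there)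
open import Data.Nat using (_≤_; _<_; z≤n)
open import Data.Nat.Properties using (≤-<-trans; <-irrefl)
open import Data.Product using (_×_; _,_; proj₁; proj₂; ∃-syntax)
open import Data.Sum using (_⊎_; inj₁; inj₂)
open import Data.Empty using (⊥-elim)
open import Relation.Nullary using (¬_; yes; no)
open import Relation.Binary.PropositionalEquality using (_≡_; _≢_; refl; sym; trans; cong; subst)
open import Function.Bundles using (Equivalence)
open import Function.Definitions using (Injective)

Fin2-pair : (p q : Fin 2) → p ≢ q → ∀ k → k ≡ p ⊎ k ≡ q
Fin2-pair zero       zero       p≢q _          = ⊥-elim (p≢q refl)
Fin2-pair zero       (suc zero) _   zero       = inj₁ refl
Fin2-pair zero       (suc zero) _   (suc zero) = inj₂ refl
Fin2-pair (suc zero) zero       _   zero       = inj₂ refl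
Fin2-pair (suc zero) zero       _   (suc zero) = inj₁ refl
Fin2-pair (suc zero) (suc zero) p≢q _          = ⊥-elim (p≢q refl)

two-others : ∀ {c p q k : Fin 3} → c ≢ p → c ≢ q → p ≢ q → c ≢ k → k ≡ p ⊎ k ≡ q
two-others c≢p c≢q p≢q c≢k
  with Fin2-pair (punchOut c≢p) (punchOut c≢q)
                 (λ eq → p≢q (punchOut-injective c≢p c≢q eq)) (punchOut c≢k)
... | inj₁ eq = inj₁ (punchOut-injective c≢k c≢p eq)
... | inj₂ eq = inj₂ (punchOut-injective c≢k c≢q eq)

injective-into⇒∣p∣≤∣q∣ : ∀ {r n} {σ : Fin r → Fin n} → Injective _≡_ _≡_ σ →
                         (p : Subset r) {q : Subset n} → (∀ x → x ∈ p → σ x ∈ q) → ∣ p ∣ ≤ ∣ q ∣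
injective-into⇒∣p∣≤∣q∣ _ [] _ = z≤n
injective-into⇒∣p∣≤∣q∣ σ-inj (outside ∷ p) into =
  injective-into⇒∣p∣≤∣q∣ (λ eq → suc-injective (σ-inj eq)) p (λ x x∈p → into (suc x) (there x∈p))
injective-into⇒∣p∣≤∣q∣ σ-inj (inside ∷ p) into =
  ≤-<-trans
    (injective-into⇒∣p∣≤∣q∣ (λ eq → suc-injective (σ-inj eq)) p
      (λ x x∈p → x∈p∧x≢y⇒x∈p-y (into (suc x) (there x∈p)) (λ eq → 0≢1+n (sym (σ-inj eq)))))
    (x∈p⇒∣p-x∣<∣p∣ (into zero here))

injective-into⇒∣p∣<∣q∣ : ∀ {r n} {σ : Fin r → Fin n} → Injective _≡_ _≡_ σ →
                         (p : Subset r) {q : Subset n} → (∀ x → x ∈ p → σ x ∈ q) →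
                         ∀ {y} → y ∉ p → σ y ∈ q → ∣ p ∣ < ∣ q ∣
injective-into⇒∣p∣<∣q∣ σ-inj p into y∉p σy∈q =
  ≤-<-trans
    (injective-into⇒∣p∣≤∣q∣ σ-inj p
      (λ x x∈p → x∈p∧x≢y⇒x∈p-y (into x x∈p) (λ eq → y∉p (subst (_∈ p) (σ-inj eq) x∈p))))
    (x∈p⇒∣p-x∣<∣p∣ σy∈q)

module _ (H : Hyp) where

  ∈E⇒edge-at-class : ∀ {v e k} → cls H v ≡ k → _∈E_ H v e → edge H e k ≡ v
  ∈E⇒edge-at-class {e = e} cv≡k (k′ , eq)
    with trans (sym (edge-cls H e k′)) (trans (cong (cls H) eq) cv≡k)
  ... | refl = eq

  PrivateEdge : (Fin (n H) → Set) → Fin (n H) → Fin (m H) → Set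
  PrivateEdge S v e = ∀ k → S (edge H e k) → edge H e k ≡ v

  private-edges⇒minimal-cover : ∀ {S} → IsCover H S →
                                (∀ v → S v → ∃[ e ] PrivateEdge S v e) → IsMinimalCover H S
  private-edges⇒minimal-cover {S} S-cover has-private-edge = S-cover , minimal
    where
    minimal : ∀ S′ → (∀ v → S′ v → S v) → IsCover H S′ → ∀ v → S v → S′ v
    minimal S′ S′⊆S S′-cover v v∈S with has-private-edge v v∈S
    ... | e , e-private with S′-cover e
    ...   | k , ek∈S′ = subst S′ (e-private k (S′⊆S _ ek∈S′)) ek∈S′

  fano-lines-cover : ∀ s → ∃[ t ] ∃[ k ] fanoTriple H t k ≡ s
  fano-lines-cover zero                                = zero , zero , refl
  fano-lines-cover (suc zero)                          = zero , suc zero , refl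
  fano-lines-cover (suc (suc zero))                    = zero , suc (suc zero) , refl
  fano-lines-cover (suc (suc (suc zero)))              = suc (suc zero) , zero , refl
  fano-lines-cover (suc (suc (suc (suc zero))))        = suc zero , suc zero , refl
  fano-lines-cover (suc (suc (suc (suc (suc zero))))) = suc zero , suc (suc zero) , refl

module _ {H : Hyp} (P : FRPartition H) where
  open FRPartition P

  rv-injectiveˡ : ∀ {R R′ k k′} → rv R k ≡ rv R′ k′ → R ≡ R′
  rv-injectiveˡ {R} {R′} {k} {k′} eq with disjoint {inj₂ (R , k)} {inj₂ (R′ , k′)} eq
  ... | refl = refl

  fv≢rv : ∀ {F s R k} → fv F s ≢ rv R k
  fv≢rv {F} {s} {R} {k} eq with disjoint {inj₁ (F , s)} {inj₂ (R , k)} eq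
  ... | ()

  InW⇒¬InFR : ∀ {v} → InW v → ¬ InFR v
  InW⇒¬InFR (∉F , _) (inj₁ (F , s , eq)) = ∉F F s eq
  InW⇒¬InFR (_ , ∉R) (inj₂ (R , k , eq)) = ∉R R k eq

  InFR⊎InW : ∀ v → InFR v ⊎ InW v
  InFR⊎InW v with any? (λ F → any? (λ s → fv F s ≟ v)) | any? (λ R → any? (λ k → rv R k ≟ v))
  ... | yes in-F | _        = inj₁ (inj₁ in-F)
  ... | no _     | yes in-R = inj₁ (inj₂ in-R)
  ... | no ∉F    | no ∉R    = inj₂ ((λ F s eq → ∉F (F , s , eq)) , (λ R k eq → ∉R (R , k , eq)))

  rv∈E⇒edge-at : ∀ {e R k} → _∈E_ H (rv R k) e → edge H e k ≡ rv R k
  rv∈E⇒edge-at {R = R} {k} = ∈E⇒edge-at-class H (rcls R k)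

  hit-or-others-hit : ∀ {e R} → ContainsTwo e R → ∀ c →
                      edge H e c ≡ rv R c ⊎ (∀ k → k ≢ c → edge H e k ≡ rv R k)
  hit-or-others-hit {e} {R} (p , q , p≢q , p∈e , q∈e) c with c ≟ p | c ≟ q
  ... | yes refl | _        = inj₁ (rv∈E⇒edge-at p∈e)
  ... | no _     | yes refl = inj₁ (rv∈E⇒edge-at q∈e)
  ... | no c≢p   | no c≢q   = inj₂ others
    where
    others : ∀ k → k ≢ c → edge H e k ≡ rv R k
    others k k≢c with two-others c≢p c≢q p≢q (λ eq → k≢c (sym eq))
    ... | inj₁ refl = rv∈E⇒edge-at p∈e
    ... | inj₂ refl = rv∈E⇒edge-at q∈e

  ReplacementEdge : Fin r → Fin 3 → Fin (n H) → Fin (m H) → Set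
  ReplacementEdge R c w e = edge H e c ≡ w × (∀ k → k ≢ c → edge H e k ≡ rv R k)

  Adj⇒replacement-edge : ∀ {c R w} → Adj c R w → ∃[ e ] ReplacementEdge R c w e
  Adj⇒replacement-edge {c} {R} (cw≡c , w∈W , e , w∈e , two) with hit-or-others-hit two c
  ... | inj₁ hit    = ⊥-elim (proj₂ w∈W R c (trans (sym hit) (∈E⇒edge-at-class H cw≡c w∈e)))
  ... | inj₂ others = e , ∈E⇒edge-at-class H cw≡c w∈e , others

  replacement-edge-private : ∀ {S R c w e v} → ReplacementEdge R c w e →
                             (S w → w ≡ v) → (∀ k → k ≢ c → S (rv R k) → rv R k ≡ v) →
                             PrivateEdge H S v e
  replacement-edge-private {S} {c = c} (at-c , elsewhere) w-only rv-only k ek∈S with k ≟ c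
  ... | yes refl = trans at-c (w-only (subst S at-c ek∈S))
  ... | no k≢c   = trans (elsewhere k k≢c) (rv-only k k≢c (subst S (elsewhere k k≢c) ek∈S))

  partner-outside⇒∉ : ∀ {i U C} → NbhdIs i U C → ∣ U ∣ ≡ ∣ C ∣ →
                      (σ : Saturating i) → ∀ {R} → R ∉ U → proj₁ σ R ∉ C
  partner-outside⇒∉ {U = U} {C} N[U]≡C ∣U∣≡∣C∣ (σ , σ-injective , σ-adj) R∉U σR∈C =
    <-irrefl ∣U∣≡∣C∣ (injective-into⇒∣p∣<∣q∣ σ-injective U U↦C R∉U σR∈C)
    where
    U↦C : ∀ R → R ∈ U → σ R ∈ C
    U↦C R R∈U = Equivalence.from (N[U]≡C (σ R)) (R , R∈U , σ-adj R)

module HeavyCoverProof {H : Hyp} (P : FRPartition H) (HB : IsHomeBase H P)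
  {i j : Fin 3} (i≢j : i ≢ j)
  {C : Subset (n H)} (C⊆W∩Vᵢ : ∀ w → w ∈ C → cls H w ≡ i × FRPartition.InW P w)
  {U : Subset (FRPartition.r P)} (∣U∣≡∣C∣ : ∣ U ∣ ≡ ∣ C ∣) (N[U]≡C : FRPartition.NbhdIs P i U C)
  where
  open FRPartition P

  T : Fin (n H) → Set
  T = HeavyCover i j C U

  T∩W⊆C : ∀ {w} → InW w → T w → w ∈ C
  T∩W⊆C _   (inj₁ w∈C)                         = w∈C
  T∩W⊆C w∈W (inj₂ (inj₁ (_ , fr)))             = ⊥-elim (InW⇒¬InFR P w∈W fr)
  T∩W⊆C w∈W (inj₂ (inj₂ (_ , R , _ , k , eq))) = ⊥-elim (InW⇒¬InFR P w∈W (inj₂ (R , k , eq)))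

  T-rv : ∀ {R k} → T (rv R k) → k ≡ i ⊎ (k ≡ j × R ∉ U)
  T-rv {R} {k} (inj₁ rv∈C) = ⊥-elim (proj₂ (proj₂ (C⊆W∩Vᵢ _ rv∈C)) R k refl)
  T-rv {R} {k} (inj₂ (inj₁ (cls≡i , _))) = inj₁ (trans (sym (rcls R k)) cls≡i)
  T-rv {R} {k} (inj₂ (inj₂ (cls≡j , R′ , R′∉U , _ , eq))) =
    inj₂ (trans (sym (rcls R k)) cls≡j , subst (_∉ U) (rv-injectiveˡ P eq) R′∉U)

  T-fv : ∀ {F s} → T (fv F s) → cls H (fv F s) ≡ i
  T-fv {F} {s} (inj₁ fv∈C)                        = ⊥-elim (proj₁ (proj₂ (C⊆W∩Vᵢ _ fv∈C)) F s refl)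
  T-fv         (inj₂ (inj₁ (cls≡i , _)))          = cls≡i
  T-fv         (inj₂ (inj₂ (_ , _ , _ , _ , eq))) = ⊥-elim (fv≢rv P (sym eq))

  covers-two : ∀ e R → ContainsTwo e R → ∃[ k ] T (edge H e k)
  covers-two e R two with hit-or-others-hit P two i | R ∈? U
  ... | inj₁ hit-i  | _       = i , inj₂ (inj₁ (edge-cls H e i , inj₂ (R , i , sym hit-i)))
  ... | inj₂ others | no R∉U  =
    j , inj₂ (inj₂ (edge-cls H e j , R , R∉U , j , sym (others j (λ eq → i≢j (sym eq)))))
  ... | inj₂ _      | yes R∈U with InFR⊎InW P (edge H e i)
  ...   | inj₁ fr  = i , inj₂ (inj₁ (edge-cls H e i , fr))
  ...   | inj₂ w∈W = i , inj₁ (Equivalence.from (N[U]≡C _)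
                               (R , R∈U , edge-cls H e i , w∈W , e , (i , refl) , two))

  T-cover : IsCover H T
  T-cover e with proj₂ HB e
  ... | inj₁ (F , e⊆F) = i , inj₂ (inj₁ (edge-cls H e i , inj₁ (F , e⊆F i)))
  ... | inj₂ (R , two) = covers-two e R two

  private-C : ∀ {v} → v ∈ C → ∃[ e ] PrivateEdge H T v e
  private-C {v} v∈C with Equivalence.to (N[U]≡C v) v∈C
  ... | R , R∈U , adj with Adj⇒replacement-edge P adj
  ...   | e , replaced = e , replacement-edge-private P {S = T} replaced (λ _ → refl) rv-only
    where
    rv-only : ∀ k → k ≢ i → T (rv R k) → rv R k ≡ v
    rv-only k k≢i k∈T with T-rv k∈T
    ... | inj₁ k≡i       = ⊥-elim (k≢i k≡i)
    ... | inj₂ (_ , R∉U) = ⊥-elim (R∉U R∈U)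

  private-fv : ∀ F s → cls H (fv F s) ≡ i → ∃[ e ] PrivateEdge H T (fv F s) e
  private-fv F s cls≡i with fano-lines-cover H s
  ... | t , k₀ , t∋s with proj₂ (proj₂ (fano F)) t
  ...   | e , e≈t = e , only-at-i
    where
    fv∈e : _∈E_ H (fv F s) e
    fv∈e = Equivalence.from (e≈t (fv F s)) (k₀ , cong (fv F) t∋s)
    at-i : ∀ k → T (edge H e k) → k ≡ i
    at-i k ek∈T with Equivalence.to (e≈t (edge H e k)) (k , refl)
    ... | _ , eq = trans (sym (edge-cls H e k))
                         (subst (λ x → cls H x ≡ i) eq (T-fv (subst T (sym eq) ek∈T)))
    only-at-i : PrivateEdge H T (fv F s) e
    only-at-i k ek∈T with at-i k ek∈T
    ... | refl = ∈E⇒edge-at-class H cls≡i fv∈e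

  private-rv-i : ∀ R → ∃[ e ] PrivateEdge H T (rv R i) e
  private-rv-i R with proj₁ HB j
  ... | σ , _ , σ-adj with Adj⇒replacement-edge P (σ-adj R)
  ...   | e , replaced = e , replacement-edge-private P {S = T} replaced partner-only rv-only
    where
    partner-only : T (σ R) → σ R ≡ rv R i
    partner-only σR∈T = ⊥-elim (i≢j (trans (sym (proj₁ (C⊆W∩Vᵢ _ σR∈C))) (proj₁ (σ-adj R))))
      where σR∈C = T∩W⊆C (proj₁ (proj₂ (σ-adj R))) σR∈T
    rv-only : ∀ k → k ≢ j → T (rv R k) → rv R k ≡ rv R i
    rv-only k k≢j k∈T with T-rv k∈T
    ... | inj₁ refl      = refl
    ... | inj₂ (k≡j , _) = ⊥-elim (k≢j k≡j)

  private-rv-j : ∀ {R} → R ∉ U → ∃[ e ] PrivateEdge H T (rv R j) e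
  private-rv-j {R} R∉U with proj₁ HB i
  ... | σ , σ-injective , σ-adj with Adj⇒replacement-edge P (σ-adj R)
  ...   | e , replaced = e , replacement-edge-private P {S = T} replaced partner-only rv-only
    where
    partner-only : T (σ R) → σ R ≡ rv R j
    partner-only σR∈T = ⊥-elim (partner-outside⇒∉ P N[U]≡C ∣U∣≡∣C∣ (σ , σ-injective , σ-adj) R∉U
                               (T∩W⊆C (proj₁ (proj₂ (σ-adj R))) σR∈T))
    rv-only : ∀ k → k ≢ i → T (rv R k) → rv R k ≡ rv R j
    rv-only k k≢i k∈T with T-rv k∈T
    ... | inj₁ k≡i        = ⊥-elim (k≢i k≡i)
    ... | inj₂ (refl , _) = refl

  private-edge : ∀ v → T v → ∃[ e ] PrivateEdge H T v e
  private-edge _ (inj₁ v∈C) = private-C v∈C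
  private-edge _ (inj₂ (inj₁ (cls≡i , inj₁ (F , s , refl)))) = private-fv F s cls≡i
  private-edge _ (inj₂ (inj₁ (cls≡i , inj₂ (R , k , refl)))) with trans (sym (rcls R k)) cls≡i
  ... | refl = private-rv-i R
  private-edge _ (inj₂ (inj₂ (cls≡j , R , R∉U , k , refl))) with trans (sym (rcls R k)) cls≡j
  ... | refl = private-rv-j R∉U

proposition4p7 : (H : Hyp) (P : FRPartition H) → IsHomeBase H P →
    (i j : Fin 3) → i ≢ j →
    (C : Subset (n H)) → FRPartition.IsMaxEssential P i C →
    (U : Subset (FRPartition.r P)) → ∣ U ∣ ≡ ∣ C ∣ → FRPartition.NbhdIs P i U C →
    IsMinimalCover H (FRPartition.HeavyCover P i j C U)
proposition4p7 H P HB i j i≢j C ((C⊆W∩Vᵢ , _) , _) U ∣U∣≡∣C∣ N[U]≡C =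
  private-edges⇒minimal-cover H T-cover private-edge
  where open HeavyCoverProof P HB i≢j C⊆W∩Vᵢ ∣U∣≡∣C∣ N[U]≡C
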